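{- $\mathbf{Six}$ is finitely gently explosive with respect to $\bigcirc(p)=\{\Delta p\vee\Delta\neg p\}$ and $\neg$. That is, writing $\circ\alpha=\Delta\alpha\vee\Delta\neg\alpha$: (a) there are formulas $\alpha,\beta$ with $\circ\alpha,\alpha\not\models_{\mathbf{Six}}\beta$ and $\circ\alpha,\neg\alpha\not\models_{\mathbf{Six}}\beta$; and (b) for all formulas $\alpha,\beta$, $\circ\alpha,\alpha,\neg\alpha\models_{\mathbf{Six}}\beta$.
   Context: An involutive Stone algebra is a De Morgan algebra (bounded distributive lattice with $\neg\neg x=x$, $\neg(x\wedge y)=\neg x\vee\neg y$) with a unary $\nabla$ satisfying $\nabla0=0$, $a\wedge\nabla a=a$, $\nabla(a\wedge b)=\nabla a\wedge\nabla b$, $\neg\nabla a\wedge\nabla a=0$; the class is $\mathbf S$. $Fm$ is the set of formulas over a denumerable set of propositional variables built from binary $\wedge,\vee$, unary $\neg,\nabla$ and constants $\bot,\top$; homomorphisms send $\bot\mapsto0,\top\mapsto1$. $\Delta\alpha$ abbreviates $\neg\nabla\neg\alpha$. The logic $\mathbf{Six}$: for nonempty finite premises, $\alpha_1,\dots,\alpha_n\models_{\mathbf{Six}}\alpha$ iff for every $A\in\mathbf S$, every homomorphism $v:\mathfrak{Fm}\to A$ and every $a\in A$, if $v(\alpha_i)\ge a$ for all $i$ then $v(\alpha)\ge a$ (empty premises: $v(\alpha)=1$ for all $A,v$). A logic is finitely gently explosive with respect to a finite set $\bigcirc(p)$ of formulas in one variable $p$ and a negation $\neg$ if (a) and (b)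 hold with $\bigcirc(\alpha)$ in place of $\circ\alpha$. -}

module Defs where

open import Data.Nat using (ℕ)
open import Data.List using (List; []; _∷_)
open import Data.List.Relation.Unary.All using (All)
open import Relation.Binary.PropositionalEquality using (_≡_)
open import Level using (Level; suc; _⊔_)

record InvStoneAlgebra : Set₁ where
  infixr 6 _∧_
  infixr 5 _∨_
  field
    Carrier : Set
    _∧_ _∨_ : Carrier → Carrier → Carrier
    ¬_ ∇_   : Carrier → Carrier
    𝟘 𝟙     : Carrier
    ∧-assoc : ∀ x y z → (x ∧ y) ∧ z ≡ x ∧ (y ∧ z)
    ∨-assoc : ∀ x y z → (x ∨ y) ∨ z ≡ x ∨ (y ∨ z)
    ∧-comm  : ∀ x y → x ∧ y ≡ y ∧ x
    ∨-comm  : ∀ x y → x ∨ y ≡ y ∨ x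
    ∧-absorbs-∨ : ∀ x y → x ∧ (x ∨ y) ≡ x
    ∨-absorbs-∧ : ∀ x y → x ∨ (x ∧ y) ≡ x
    ∧-distrib-∨ : ∀ x y z → x ∧ (y ∨ z) ≡ (x ∧ y) ∨ (x ∧ z)
    ∨-identity : ∀ x → x ∨ 𝟘 ≡ x
    ∧-identity : ∀ x → x ∧ 𝟙 ≡ x
    ¬¬-involutive : ∀ x → ¬ (¬ x) ≡ x
    ¬-∧ : ∀ x y → ¬ (x ∧ y) ≡ (¬ x) ∨ (¬ y)
    ∇-𝟘 : ∇ 𝟘 ≡ 𝟘
    ∇-inflate : ∀ a → a ∧ (∇ a) ≡ a
    ∇-∧ : ∀ a b → ∇ (a ∧ b) ≡ (∇ a) ∧ (∇ b)
    ∇-compl : ∀ a → (¬ (∇ a)) ∧ (∇ a) ≡ 𝟘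

  _≤_ : Carrier → Carrier → Set
  a ≤ b = a ∧ b ≡ a

data Fm : Set where
  var   : ℕ → Fm
  _∧ᶠ_ _∨ᶠ_ : Fm → Fm → Fm
  ¬ᶠ_ ∇ᶠ_ : Fm → Fm
  ⊥ᶠ ⊤ᶠ : Fm

Δᶠ_ : Fm → Fm
Δᶠ α = ¬ᶠ (∇ᶠ (¬ᶠ α))

∘ᶠ_ : Fm → Fm
∘ᶠ α = (Δᶠ α) ∨ᶠ (Δᶠ (¬ᶠ α))

-- homomorphisms Fm → A are exactly the unique extensions of assignments
module _ (A : InvStoneAlgebra) where
  open InvStoneAlgebra A
  eval : (ℕ → Carrier) → Fm → Carrier
  eval v (var n) = v n
  eval v (φ ∧ᶠ ψ) = eval v φ ∧ eval v ψ
  eval v (φ ∨ᶠ ψ) = eval v φ ∨ eval v ψ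
  eval v (¬ᶠ φ) = ¬ eval v φ
  eval v (∇ᶠ φ) = ∇ eval v φ
  eval v ⊥ᶠ = 𝟘
  eval v ⊤ᶠ = 𝟙

_⊨Six_ : List Fm → Fm → Set₁
[] ⊨Six α = ∀ (A : InvStoneAlgebra) (v : ℕ → InvStoneAlgebra.Carrier A) →
  eval A v α ≡ InvStoneAlgebra.𝟙 A
(γ ∷ Γ) ⊨Six α = ∀ (A : InvStoneAlgebra) (v : ℕ → InvStoneAlgebra.Carrier A)
  (a : InvStoneAlgebra.Carrier A) →
  All (λ δ → InvStoneAlgebra._≤_ A a (eval A v δ)) (γ ∷ Γ) →
  InvStoneAlgebra._≤_ A a (eval A v α)

{-# OPTIONS --safe #-}
module Submission where

open import Defs
open import Data.Bool as Bool using (Bool; true; false)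
open import Data.List using ([]; _∷_)
open import Data.List.Relation.Unary.All using ([]; _∷_)
open import Data.Nat using (ℕ; zero; suc)
open import Data.Product using (_×_; ∃₂; _,_)
open import Relation.Binary.PropositionalEquality using (_≡_; refl; sym; trans; subst; cong; cong₂; module ≡-Reasoning)
open import Relation.Nullary using (¬_)

-- Every Stone operator satisfies x ∧ ¬∇x = 0, so an element below x, ¬x and
-- ∘x = ¬∇¬x ∨ ¬∇x is 0, and 0 lies below any conclusion.  Conversely the
-- two-element Boolean algebra with ∇ = id separates ∘α, α (resp. ∘α, ¬α)
-- from a false variable.

module Properties (A : InvStoneAlgebra) where
  open InvStoneAlgebra A renaming (¬_ to ~_)
  open ≡-Reasoning

  ∧-zeroˡ : ∀ x → 𝟘 ∧ x ≡ 𝟘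
  ∧-zeroˡ x = begin
    𝟘 ∧ x       ≡⟨ cong (𝟘 ∧_) (sym (∨-identity x)) ⟩
    𝟘 ∧ (x ∨ 𝟘) ≡⟨ cong (𝟘 ∧_) (∨-comm x 𝟘) ⟩
    𝟘 ∧ (𝟘 ∨ x) ≡⟨ ∧-absorbs-∨ 𝟘 x ⟩
    𝟘           ∎

  ∧-zeroʳ : ∀ x → x ∧ 𝟘 ≡ 𝟘
  ∧-zeroʳ x = begin
    x ∧ 𝟘 ≡⟨ ∧-comm x 𝟘 ⟩
    𝟘 ∧ x ≡⟨ ∧-zeroˡ x ⟩
    𝟘     ∎

  𝟘-≤ : ∀ x → 𝟘 ≤ x
  𝟘-≤ = ∧-zeroˡ

  x∧¬∇x≡𝟘 : ∀ x → x ∧ ~ ∇ x ≡ 𝟘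
  x∧¬∇x≡𝟘 x = begin
    x ∧ ~ ∇ x           ≡⟨ cong (_∧ ~ ∇ x) (sym (∇-inflate x)) ⟩
    (x ∧ ∇ x) ∧ ~ ∇ x   ≡⟨ ∧-assoc x _ _ ⟩
    x ∧ (∇ x ∧ ~ ∇ x)   ≡⟨ cong (x ∧_) (∧-comm _ _) ⟩
    x ∧ (~ ∇ x ∧ ∇ x)   ≡⟨ cong (x ∧_) (∇-compl x) ⟩
    x ∧ 𝟘               ≡⟨ ∧-zeroʳ x ⟩
    𝟘                   ∎

  ≤-disjoint : ∀ {a x y} → a ≤ x → x ∧ y ≡ 𝟘 → a ∧ y ≡ 𝟘
  ≤-disjoint {a} {x} {y} a≤x x∧y≡𝟘 = begin
    a ∧ y       ≡⟨ cong (_∧ y) (sym a≤x) ⟩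
    (a ∧ x) ∧ y ≡⟨ ∧-assoc a x y ⟩
    a ∧ (x ∧ y) ≡⟨ cong (a ∧_) x∧y≡𝟘 ⟩
    a ∧ 𝟘       ≡⟨ ∧-zeroʳ a ⟩
    𝟘           ∎

  ≤-∘-inconsistent : ∀ {a x} → a ≤ (~ ∇ ~ x ∨ ~ ∇ ~ ~ x) → a ≤ x → a ≤ (~ x) → a ≡ 𝟘
  ≤-∘-inconsistent {a} {x} a≤∘x a≤x a≤¬x = begin
    a                                   ≡⟨ sym a≤∘x ⟩
    a ∧ (~ ∇ ~ x ∨ ~ ∇ ~ ~ x)           ≡⟨ ∧-distrib-∨ a _ _ ⟩
    a ∧ ~ ∇ ~ x ∨ a ∧ ~ ∇ ~ ~ x         ≡⟨ cong₂ _∨_ a∧Δx≡𝟘 a∧Δ¬x≡𝟘 ⟩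
    𝟘 ∨ 𝟘                               ≡⟨ ∨-identity 𝟘 ⟩
    𝟘                                   ∎
    where
    a∧Δx≡𝟘 : a ∧ ~ ∇ ~ x ≡ 𝟘
    a∧Δx≡𝟘 = ≤-disjoint a≤¬x (x∧¬∇x≡𝟘 (~ x))

    a∧Δ¬x≡𝟘 : a ∧ ~ ∇ ~ ~ x ≡ 𝟘
    a∧Δ¬x≡𝟘 = ≤-disjoint a≤x (trans (cong (λ y → x ∧ ~ ∇ y) (¬¬-involutive x)) (x∧¬∇x≡𝟘 x))

gentle-explosion : ∀ α β → (∘ᶠ α ∷ α ∷ ¬ᶠ α ∷ []) ⊨Six β
gentle-explosion α β A v a (a≤∘α ∷ a≤α ∷ a≤¬α ∷ []) =
  subst (_≤ eval A v β) (sym a≡𝟘) (𝟘-≤ (eval A v β))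
  where
  open InvStoneAlgebra A using (_≤_; 𝟘)
  open Properties A

  a≡𝟘 : a ≡ 𝟘
  a≡𝟘 = ≤-∘-inconsistent a≤∘α a≤α a≤¬α

𝔹 : InvStoneAlgebra
𝔹 = record
  { Carrier = Bool ; _∧_ = Bool._∧_ ; _∨_ = Bool._∨_ ; ¬_ = Bool.not ; ∇_ = λ x → x
  ; 𝟘 = false ; 𝟙 = true
  ; ∧-assoc = λ { true _ _ → refl ; false _ _ → refl }
  ; ∨-assoc = λ { true _ _ → refl ; false _ _ → refl }
  ; ∧-comm = λ { true true → refl ; true false → refl ; false true → refl ; false false → refl }
  ; ∨-comm = λ { true true → refl ; true false → refl ; false true → refl ; false false → refl }
  ; ∧-absorbs-∨ = λ { true _ → refl ; false _ → refl }
  ; ∨-absorbs-∧ = λ { true _ → refl ; false _ → refl }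
  ; ∧-distrib-∨ = λ { true _ _ → refl ; false _ _ → refl }
  ; ∨-identity = λ { true → refl ; false → refl }
  ; ∧-identity = λ { true → refl ; false → refl }
  ; ¬¬-involutive = λ { true → refl ; false → refl }
  ; ¬-∧ = λ { true _ → refl ; false _ → refl }
  ; ∇-𝟘 = refl
  ; ∇-inflate = λ { true → refl ; false → refl }
  ; ∇-∧ = λ _ _ → refl
  ; ∇-compl = λ { true → refl ; false → refl }
  }

only-var0-true : ℕ → Bool
only-var0-true zero    = true
only-var0-true (suc _) = false

∘p,p⊭q : ¬ ((∘ᶠ var 0 ∷ var 0 ∷ []) ⊨Six var 1)
∘p,p⊭q ⊨ with ⊨ 𝔹 only-var0-true true (refl ∷ refl ∷ [])
... | ()

∘p,¬p⊭q : ¬ ((∘ᶠ var 0 ∷ ¬ᶠ var 0 ∷ []) ⊨Six var 1)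
∘p,¬p⊭q ⊨ with ⊨ 𝔹 (λ _ → false) true (refl ∷ refl ∷ [])
... | ()

mainTheorem4 : (∃₂ λ α β → (¬ (((∘ᶠ α) ∷ α ∷ []) ⊨Six β)) × (¬ (((∘ᶠ α) ∷ (¬ᶠ α) ∷ []) ⊨Six β)))
    × (∀ α β → ((∘ᶠ α) ∷ α ∷ (¬ᶠ α) ∷ []) ⊨Six β)
mainTheorem4 = (var 0 , var 1 , ∘p,p⊭q , ∘p,¬p⊭q) , gentle-explosion
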